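{- Let $G=(A,B,\mathcal{E})$ be a bipartite graph containing no induced $n\Lambda_k$. Then there is a set $S\subseteq A$ with $|S|\le n-1$ such that $|N(a)\setminus N(S)|<k$ for all $a\in A$.
   Context: $\Lambda_k$ is the star with centre in the top part $A$ and $k$ leaves in the bottom part $B$; $n\Lambda_k$ is the disjoint union of $n$ copies; induced containment respects sides. $N(S)=\bigcup_{v\in S}N(v)$. -}

module Defs where

open import Data.Nat using (ℕ; zero; suc)
open import Data.Bool using (true; false)
open import Data.Fin using (Fin)
import Data.Fin as F
open import Data.Fin.Subset using (Subset; ⊥; _∪_; _∈_; _∉_)
open import Data.Vec using (_∷_; [])
open import Data.Product using (Σ; _×_)
open import Relation.Binary.PropositionalEquality using (_≡_; _≢_)

-- A finite bipartite graph G = (A, B, E) with A = Fin p (top part),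
-- B = Fin q (bottom part); E a is the neighbourhood N(a) ⊆ B of a ∈ A.
BipGraph : ℕ → ℕ → Set
BipGraph p q = Fin p → Subset q

NS : {p q : ℕ} → BipGraph p q → Subset p → Subset q
NS {zero}  E []          = ⊥
NS {suc p} E (true ∷ S)  = E F.zero ∪ NS (λ a → E (F.suc a)) S
NS {suc p} E (false ∷ S) = NS (λ a → E (F.suc a)) S

-- G contains an induced copy of n Λ_k respecting sides:
-- distinct centres c i ∈ A (i < n), pairwise distinct leaves L i j ∈ B
-- (i < n, j < k), L i j adjacent to c i, and L i' j non-adjacent to c i
-- whenever i ≠ i'.  (No A–A or B–B edges exist in a bipartite graph.)
ContainsInduced-nΛ : {p q : ℕ} → BipGraph p q → ℕ → ℕ → Set
ContainsInduced-nΛ {p} {q} E n k =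
  Σ (Fin n → Fin p) λ c →
  Σ (Fin n → Fin k → Fin q) λ L →
    (∀ i i' → c i ≡ c i' → i ≡ i')
  × (∀ i j i' j' → L i j ≡ L i' j' → (i ≡ i') × (j ≡ j'))
  × (∀ i j → L i j ∈ E (c i))
  × (∀ i i' j → i ≢ i' → L i' j ∉ E (c i))

module Submission where

-- Proof idea: hill climbing on |N(S)| over the sets with |S| ≤ n - 1.  If S
-- does not cover G, pick a with at least k neighbours outside N(S).  If
-- |S| < n - 1, then S ∪ {a} has a larger neighbourhood.  Otherwise either an
-- exchange S - i + a (i ∈ S) has a larger neighbourhood, or no exchange helps;
-- in that case the exchange lemma shows that every i ∈ S has at least k private
-- neighbours (outside N(S - i)) not adjacent to a.  These, together with k
-- neighbours of a outside N(S), are the leaves of an induced nΛ_k with centres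
-- S ∪ {a}: a contradiction.  Since |N(S)| ≤ |B|, the climb stops at a cover.

open import Defs
open import Data.Nat using (ℕ; _≤_; _<_; _∸_; suc; zero; _+_; z≤n; s≤s; _<?_)
open import Data.Nat.Properties
open import Data.Bool using (true; false)
open import Data.Fin using (Fin; inject≤) renaming (zero to fz; suc to fs)
open import Data.Fin.Properties using (any?; all?; ¬∀⟶∃¬; inject≤-injective)
  renaming (_≟_ to _≟F_; suc-injective to fs-injective)
open import Data.Fin.Subset using (Subset; ∣_∣; _─_; _-_; _∈_; _∉_; _⊆_; _∪_; _∩_; ⁅_⁆; ⊥)
open import Data.Fin.Subset.Properties
  using (_∈?_; x∈p∪q⁻; p⊆p∪q; q⊆p∪q; p⊆q⇒∣p∣≤∣q∣; ∣⁅x⁆∣≡1; x∈⁅x⁆; ∉⊥; ∣p∣≤n; ∣⊥∣≡0;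
         x∈p⇒∣p-x∣<∣p∣; x∈p∧x∉q⇒x∈p─q; p─q⊆p; ∣p─q∣≤∣p∣; x∈p∧x≢y⇒x∈p-y; ∩-comm)
open import Data.Vec using (_∷_; []; here; there)
open import Data.Product using (Σ; _×_; _,_)
open import Data.Sum using (_⊎_; inj₁; inj₂)
open import Data.Empty using (⊥-elim)
open import Function using (_∘_)
open import Relation.Nullary using (¬_; yes; no)
open import Relation.Nullary.Decidable using (_×-dec_)
open import Relation.Binary.PropositionalEquality using (_≡_; _≢_; refl; sym; trans; cong; subst; subst₂)

x∈p─q⇒x∉q : ∀ {n} {x : Fin n} (p q : Subset n) → x ∈ p ─ q → x ∉ q
x∈p─q⇒x∉q (true ∷ p)  (false ∷ q) here        ()
x∈p─q⇒x∉q (_ ∷ p)     (_ ∷ q)     (there x∈) (there x∈q) = x∈p─q⇒x∉q p q x∈ x∈q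

∣p∣≡∣p─q∣+∣p∩q∣ : ∀ {n} (p q : Subset n) → ∣ p ∣ ≡ ∣ p ─ q ∣ + ∣ p ∩ q ∣
∣p∣≡∣p─q∣+∣p∩q∣ []          []          = refl
∣p∣≡∣p─q∣+∣p∩q∣ (true ∷ p)  (true ∷ q)  = trans (cong suc (∣p∣≡∣p─q∣+∣p∩q∣ p q)) (sym (+-suc _ _))
∣p∣≡∣p─q∣+∣p∩q∣ (true ∷ p)  (false ∷ q) = cong suc (∣p∣≡∣p─q∣+∣p∩q∣ p q)
∣p∣≡∣p─q∣+∣p∩q∣ (false ∷ p) (true ∷ q)  = ∣p∣≡∣p─q∣+∣p∩q∣ p q
∣p∣≡∣p─q∣+∣p∩q∣ (false ∷ p) (false ∷ q) = ∣p∣≡∣p─q∣+∣p∩q∣ p q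

∣p∪q∣≡∣p∣+∣q─p∣ : ∀ {n} (p q : Subset n) → ∣ p ∪ q ∣ ≡ ∣ p ∣ + ∣ q ─ p ∣
∣p∪q∣≡∣p∣+∣q─p∣ []          []          = refl
∣p∪q∣≡∣p∣+∣q─p∣ (true ∷ p)  (_ ∷ q)     = cong suc (∣p∪q∣≡∣p∣+∣q─p∣ p q)
∣p∪q∣≡∣p∣+∣q─p∣ (false ∷ p) (true ∷ q)  = trans (cong suc (∣p∪q∣≡∣p∣+∣q─p∣ p q)) (sym (+-suc _ _))
∣p∪q∣≡∣p∣+∣q─p∣ (false ∷ p) (false ∷ q) = ∣p∪q∣≡∣p∣+∣q─p∣ p q

-- If p is no larger than q, then p has no more elements outside q than q has
-- outside p (both sides differ from |p|, |q| by the common |p ∩ q|).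
∣p∣≤∣q∣⇒∣p─q∣≤∣q─p∣ : ∀ {n} (p q : Subset n) → ∣ p ∣ ≤ ∣ q ∣ → ∣ p ─ q ∣ ≤ ∣ q ─ p ∣
∣p∣≤∣q∣⇒∣p─q∣≤∣q─p∣ p q ∣p∣≤∣q∣ = +-cancelʳ-≤ ∣ p ∩ q ∣ _ _ (begin
  ∣ p ─ q ∣ + ∣ p ∩ q ∣  ≡⟨ sym (∣p∣≡∣p─q∣+∣p∩q∣ p q) ⟩
  ∣ p ∣                  ≤⟨ ∣p∣≤∣q∣ ⟩
  ∣ q ∣                  ≡⟨ ∣p∣≡∣p─q∣+∣p∩q∣ q p ⟩
  ∣ q ─ p ∣ + ∣ q ∩ p ∣  ≡⟨ cong (λ r → ∣ q ─ p ∣ + ∣ r ∣) (∩-comm q p) ⟩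
  ∣ q ─ p ∣ + ∣ p ∩ q ∣  ∎)
  where open ≤-Reasoning

∣t∪a∣≤∣t∪b∣⇒∣a─t∣≤∣b─t∣ : ∀ {n} (t a b : Subset n) → ∣ t ∪ a ∣ ≤ ∣ t ∪ b ∣ → ∣ a ─ t ∣ ≤ ∣ b ─ t ∣
∣t∪a∣≤∣t∪b∣⇒∣a─t∣≤∣b─t∣ t a b le =
  +-cancelˡ-≤ ∣ t ∣ _ _ (subst₂ _≤_ (∣p∪q∣≡∣p∣+∣q─p∣ t a) (∣p∪q∣≡∣p∣+∣q─p∣ t b) le)

0<∣q─p∣⇒∣p∣<∣p∪q∣ : ∀ {n} (p q : Subset n) → 0 < ∣ q ─ p ∣ → ∣ p ∣ < ∣ p ∪ q ∣
0<∣q─p∣⇒∣p∣<∣p∪q∣ p q pos = subst (∣ p ∣ <_) (sym (∣p∪q∣≡∣p∣+∣q─p∣ p q)) (m<m+n ∣ p ∣ pos)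

∣p∪⁅x⁆∣≤1+∣p∣ : ∀ {n} (p : Subset n) (x : Fin n) → ∣ p ∪ ⁅ x ⁆ ∣ ≤ suc ∣ p ∣
∣p∪⁅x⁆∣≤1+∣p∣ p x = begin
  ∣ p ∪ ⁅ x ⁆ ∣          ≡⟨ ∣p∪q∣≡∣p∣+∣q─p∣ p ⁅ x ⁆ ⟩
  ∣ p ∣ + ∣ ⁅ x ⁆ ─ p ∣  ≤⟨ +-monoʳ-≤ ∣ p ∣ (∣p─q∣≤∣p∣ ⁅ x ⁆ p) ⟩
  ∣ p ∣ + ∣ ⁅ x ⁆ ∣      ≡⟨ cong (∣ p ∣ +_) (∣⁅x⁆∣≡1 x) ⟩
  ∣ p ∣ + 1              ≡⟨ +-comm ∣ p ∣ 1 ⟩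
  suc ∣ p ∣              ∎
  where open ≤-Reasoning

enum : ∀ {n} (X : Subset n) → Fin ∣ X ∣ → Fin n
enum (true ∷ X)  fz     = fz
enum (true ∷ X)  (fs t) = fs (enum X t)
enum (false ∷ X) t      = fs (enum X t)

enum-∈ : ∀ {n} (X : Subset n) t → enum X t ∈ X
enum-∈ (true ∷ X)  fz     = here
enum-∈ (true ∷ X)  (fs t) = there (enum-∈ X t)
enum-∈ (false ∷ X) t      = there (enum-∈ X t)

enum-injective : ∀ {n} (X : Subset n) {t t'} → enum X t ≡ enum X t' → t ≡ t'
enum-injective (true ∷ X)  {fz}   {fz}    _ = refl
enum-injective (true ∷ X)  {fz}   {fs _}  ()
enum-injective (true ∷ X)  {fs _} {fz}    ()
enum-injective (true ∷ X)  {fs _} {fs _}  e = cong fs (enum-injective X (fs-injective e))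
enum-injective (false ∷ X)                e = enum-injective X (fs-injective e)

choose : ∀ {n k} (X : Subset n) → k ≤ ∣ X ∣ → Fin k → Fin n
choose X k≤∣X∣ j = enum X (inject≤ j k≤∣X∣)

choose-∈ : ∀ {n k} (X : Subset n) (k≤∣X∣ : k ≤ ∣ X ∣) j → choose X k≤∣X∣ j ∈ X
choose-∈ X k≤∣X∣ j = enum-∈ X (inject≤ j k≤∣X∣)

choose-injective : ∀ {n k} (X : Subset n) (k≤∣X∣ : k ≤ ∣ X ∣) {j j'} →
  choose X k≤∣X∣ j ≡ choose X k≤∣X∣ j' → j ≡ j'
choose-injective X k≤∣X∣ e = inject≤-injective k≤∣X∣ k≤∣X∣ _ _ (enum-injective X e)

∈NS⁺ : ∀ {p q} (E : BipGraph p q) {S : Subset p} {j x} → j ∈ S → x ∈ E j → x ∈ NS E S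
∈NS⁺ E {true ∷ S}  here        x∈Ej = p⊆p∪q _ x∈Ej
∈NS⁺ E {true ∷ S}  (there j∈S) x∈Ej = q⊆p∪q (E fz) _ (∈NS⁺ (E ∘ fs) j∈S x∈Ej)
∈NS⁺ E {false ∷ S} (there j∈S) x∈Ej = ∈NS⁺ (E ∘ fs) j∈S x∈Ej

∈NS⁻ : ∀ {p q} (E : BipGraph p q) (S : Subset p) {x} → x ∈ NS E S → Σ (Fin p) λ j → j ∈ S × x ∈ E j
∈NS⁻ E [] x∈N = ⊥-elim (∉⊥ x∈N)
∈NS⁻ E (true ∷ S) x∈N with x∈p∪q⁻ (E fz) _ x∈N
... | inj₁ x∈E0 = fz , here , x∈E0
... | inj₂ x∈N' with ∈NS⁻ (E ∘ fs) S x∈N'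
...   | j , j∈S , x∈Ej = fs j , there j∈S , x∈Ej
∈NS⁻ E (false ∷ S) x∈N with ∈NS⁻ (E ∘ fs) S x∈N
... | j , j∈S , x∈Ej = fs j , there j∈S , x∈Ej

module _ {p q : ℕ} (E : BipGraph p q) where

  NS-mono : ∀ {S S' : Subset p} → S ⊆ S' → NS E S ⊆ NS E S'
  NS-mono {S} S⊆S' x∈N with ∈NS⁻ E S x∈N
  ... | j , j∈S , x∈Ej = ∈NS⁺ E (S⊆S' j∈S) x∈Ej

  NS-∪⁅⁆ : ∀ (S : Subset p) a → NS E S ∪ E a ⊆ NS E (S ∪ ⁅ a ⁆)
  NS-∪⁅⁆ S a x∈ with x∈p∪q⁻ (NS E S) (E a) x∈
  ... | inj₁ x∈N  = NS-mono (p⊆p∪q ⁅ a ⁆) x∈N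
  ... | inj₂ x∈Ea = ∈NS⁺ E (q⊆p∪q S ⁅ a ⁆ (x∈⁅x⁆ a)) x∈Ea

  NS-⊆-NS-∪ : ∀ (S : Subset p) i → NS E S ⊆ NS E (S - i) ∪ E i
  NS-⊆-NS-∪ S i x∈N with ∈NS⁻ E S x∈N
  ... | j , j∈S , x∈Ej with j ≟F i
  ...   | yes refl = q⊆p∪q _ (E i) x∈Ej
  ...   | no j≢i   = p⊆p∪q (E i) (∈NS⁺ E (x∈p∧x≢y⇒x∈p-y j∈S j≢i) x∈Ej)

contains-0Λ : ∀ {p q k} (E : BipGraph p q) → ContainsInduced-nΛ E 0 k
contains-0Λ E = (λ ()) , (λ ()) , (λ ()) , (λ ()) , (λ ()) , (λ ())

-- Distinctness of leaves and (as k ≥ 1) of centres is automatic.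
induced-from-leafSets : ∀ {p q n k} (E : BipGraph p q) → 1 ≤ k →
  (c : Fin n → Fin p) (Z : Fin n → Subset q) (large : ∀ i → k ≤ ∣ Z i ∣) →
  (∀ i → Z i ⊆ E (c i)) → (∀ i i' → i ≢ i' → ∀ {y} → y ∈ Z i' → y ∉ E (c i)) →
  ContainsInduced-nΛ E n k
induced-from-leafSets E (s≤s _) c Z large Z⊆N Z-private =
  c , leaf , c-injective , leaf-injective , adjacent , nonadjacent
  where
  leaf : ∀ i → Fin _ → Fin _
  leaf i = choose (Z i) (large i)

  adjacent : ∀ i j → leaf i j ∈ E (c i)
  adjacent i j = Z⊆N i (choose-∈ (Z i) (large i) j)

  nonadjacent : ∀ i i' j → i ≢ i' → leaf i' j ∉ E (c i)
  nonadjacent i i' j i≢i' = Z-private i i' i≢i' (choose-∈ (Z i') (large i') j)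

  c-injective : ∀ i i' → c i ≡ c i' → i ≡ i'
  c-injective i i' ci≡ci' with i ≟F i'
  ... | yes i≡i' = i≡i'
  ... | no i≢i'  = ⊥-elim (nonadjacent i i' fz i≢i' (subst (λ v → leaf i' fz ∈ E v) (sym ci≡ci') (adjacent i' fz)))

  leaf-injective : ∀ i j i' j' → leaf i j ≡ leaf i' j' → (i ≡ i') × (j ≡ j')
  leaf-injective i j i' j' e with i ≟F i'
  ... | yes refl = refl , choose-injective (Z i) (large i) e
  ... | no i≢i'  = ⊥-elim (nonadjacent i i' j' i≢i' (subst (_∈ E (c i)) e (adjacent i j)))

module _ {p q : ℕ} (E : BipGraph p q) where

  Private : Subset p → Fin p → Subset q
  Private S i = E i ─ NS E (S - i)

  exchange : ∀ (S : Subset p) {a i} → i ∈ S → ∣ NS E ((S - i) ∪ ⁅ a ⁆) ∣ ≤ ∣ NS E S ∣ →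
    ∣ E a ─ NS E S ∣ ≤ ∣ Private S i ─ E a ∣
  exchange S {a} {i} i∈S noGain = begin
    ∣ E a ─ NS E S ∣        ≤⟨ p⊆q⇒∣p∣≤∣q∣ outside-N ⟩
    ∣ (E a ─ T) ─ (E i ─ T) ∣ ≤⟨ ∣p∣≤∣q∣⇒∣p─q∣≤∣q─p∣ (E a ─ T) (E i ─ T) gain-a≤gain-i ⟩
    ∣ (E i ─ T) ─ (E a ─ T) ∣ ≤⟨ p⊆q⇒∣p∣≤∣q∣ private-avoids-a ⟩
    ∣ (E i ─ T) ─ E a ∣       ∎
    where
    open ≤-Reasoning
    T : Subset q
    T = NS E (S - i)

    gain-a≤gain-i : ∣ E a ─ T ∣ ≤ ∣ E i ─ T ∣
    gain-a≤gain-i = ∣t∪a∣≤∣t∪b∣⇒∣a─t∣≤∣b─t∣ T (E a) (E i) (begin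
      ∣ T ∪ E a ∣                  ≤⟨ p⊆q⇒∣p∣≤∣q∣ (NS-∪⁅⁆ E (S - i) a) ⟩
      ∣ NS E ((S - i) ∪ ⁅ a ⁆) ∣   ≤⟨ noGain ⟩
      ∣ NS E S ∣                   ≤⟨ p⊆q⇒∣p∣≤∣q∣ (NS-⊆-NS-∪ E S i) ⟩
      ∣ T ∪ E i ∣                  ∎)

    outside-N : E a ─ NS E S ⊆ (E a ─ T) ─ (E i ─ T)
    outside-N {x} x∈ = x∈p∧x∉q⇒x∈p─q (x∈p∧x∉q⇒x∈p─q x∈Ea (x∉N ∘ NS-mono E (p─q⊆p S ⁅ i ⁆)))
                                     (x∉N ∘ ∈NS⁺ E i∈S ∘ p─q⊆p (E i) T)
      where
      x∈Ea : x ∈ E a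
      x∈Ea = p─q⊆p (E a) (NS E S) x∈
      x∉N : x ∉ NS E S
      x∉N = x∈p─q⇒x∉q (E a) (NS E S) x∈

    private-avoids-a : (E i ─ T) ─ (E a ─ T) ⊆ (E i ─ T) ─ E a
    private-avoids-a {x} x∈ = x∈p∧x∉q⇒x∈p─q x∈EiT
      (λ x∈Ea → x∈p─q⇒x∉q (E i ─ T) (E a ─ T) x∈ (x∈p∧x∉q⇒x∈p─q x∈Ea (x∈p─q⇒x∉q (E i) T x∈EiT)))
      where
      x∈EiT : x ∈ E i ─ T
      x∈EiT = p─q⊆p (E i ─ T) (E a ─ T) x∈

  rigid⇒induced : ∀ {k} → 1 ≤ k → (S : Subset p) (a : Fin p) → k ≤ ∣ E a ─ NS E S ∣ →
    (∀ i → i ∈ S → ∣ NS E ((S - i) ∪ ⁅ a ⁆) ∣ ≤ ∣ NS E S ∣) →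
    ContainsInduced-nΛ E (suc ∣ S ∣) k
  rigid⇒induced {k} 1≤k S a k≤gain noGain =
    induced-from-leafSets E 1≤k centre leaves large leaves⊆N leaves-private
    where
    centre : Fin (suc ∣ S ∣) → Fin p
    centre fz     = a
    centre (fs t) = enum S t

    leaves : Fin (suc ∣ S ∣) → Subset q
    leaves fz     = E a ─ NS E S
    leaves (fs t) = Private S (enum S t) ─ E a

    large : ∀ i → k ≤ ∣ leaves i ∣
    large fz     = k≤gain
    large (fs t) = ≤-trans k≤gain (exchange S (enum-∈ S t) (noGain (enum S t) (enum-∈ S t)))

    leaves⊆N : ∀ i → leaves i ⊆ E (centre i)
    leaves⊆N fz     = p─q⊆p (E a) (NS E S)
    leaves⊆N (fs t) = p─q⊆p (E (enum S t)) _ ∘ p─q⊆p (Private S (enum S t)) (E a)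

    leaves-private : ∀ i i' → i ≢ i' → ∀ {y} → y ∈ leaves i' → y ∉ E (centre i)
    leaves-private fz     fz      i≢i' _  = ⊥-elim (i≢i' refl)
    leaves-private (fs t) fz      _    y∈ = x∈p─q⇒x∉q (E a) (NS E S) y∈ ∘ ∈NS⁺ E (enum-∈ S t)
    leaves-private fz     (fs t') _    y∈ = x∈p─q⇒x∉q (Private S (enum S t')) (E a) y∈
    leaves-private (fs t) (fs t') i≢i' y∈ =
      x∈p─q⇒x∉q (E (enum S t')) _ (p─q⊆p (Private S (enum S t')) (E a) y∈)
      ∘ ∈NS⁺ E (x∈p∧x≢y⇒x∈p-y (enum-∈ S t) (i≢i' ∘ cong fs ∘ enum-injective S))

Covers : ∀ {p q} → BipGraph p q → ℕ → Subset p → Set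
Covers E k S = ∀ a → ∣ E a ─ NS E S ∣ < k

improve : ∀ {p q m k} (E : BipGraph p q) → 1 ≤ k → ¬ ContainsInduced-nΛ E (suc m) k →
  (S : Subset p) → ∣ S ∣ ≤ m →
  Covers E k S ⊎ Σ (Subset p) λ S' → ∣ S' ∣ ≤ m × ∣ NS E S ∣ < ∣ NS E S' ∣
improve {p} {m = m} {k} E 1≤k free S ∣S∣≤m with all? (λ a → ∣ E a ─ NS E S ∣ <? k)
... | yes covers = inj₁ covers
... | no ¬covers with ¬∀⟶∃¬ p _ (λ a → ∣ E a ─ NS E S ∣ <? k) ¬covers
... | a , ¬small with ≮⇒≥ ¬small | ∣ S ∣ <? m
...   | k≤gain | yes ∣S∣<m = inj₂ (S ∪ ⁅ a ⁆ , ≤-trans (∣p∪⁅x⁆∣≤1+∣p∣ S a) ∣S∣<m , add-a-grows)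
  where
  add-a-grows : ∣ NS E S ∣ < ∣ NS E (S ∪ ⁅ a ⁆) ∣
  add-a-grows = ≤-trans (0<∣q─p∣⇒∣p∣<∣p∪q∣ (NS E S) (E a) (≤-trans 1≤k k≤gain))
                        (p⊆q⇒∣p∣≤∣q∣ (NS-∪⁅⁆ E S a))
...   | k≤gain | no ∣S∣≮m with any? (λ i → (i ∈? S) ×-dec (∣ NS E S ∣ <? ∣ NS E ((S - i) ∪ ⁅ a ⁆) ∣))
...     | yes (i , i∈S , gain) =
  inj₂ ((S - i) ∪ ⁅ a ⁆ , ≤-trans (∣p∪⁅x⁆∣≤1+∣p∣ (S - i) a) (≤-trans (x∈p⇒∣p-x∣<∣p∣ i∈S) ∣S∣≤m) , gain)
...     | no noGain = ⊥-elim (free (subst (λ n → ContainsInduced-nΛ E n k) (cong suc ∣S∣≡m)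
            (rigid⇒induced E 1≤k S a k≤gain (λ i i∈S → ≮⇒≥ (λ gain → noGain (i , i∈S , gain))))))
  where
  ∣S∣≡m : ∣ S ∣ ≡ m
  ∣S∣≡m = ≤-antisym ∣S∣≤m (≮⇒≥ ∣S∣≮m)

hill-climb : ∀ {A : Set} (Admissible Good : A → Set) (f : A → ℕ) (bound : ℕ) →
  (∀ x → f x ≤ bound) →
  (∀ x → Admissible x → Good x ⊎ Σ A λ y → Admissible y × f x < f y) →
  ∀ x → Admissible x → Σ A λ y → Admissible y × Good y
hill-climb {A} Admissible Good f bound bounded step x₀ adm₀ = climb bound x₀ adm₀ (m≤m+n bound (f x₀))
  where
  -- d bounds the number of improvements still possible from x.
  climb : ∀ d x → Admissible x → bound ≤ d + f x → Σ A λ y → Admissible y × Good y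
  climb d x adm room with step x adm
  ... | inj₁ good = x , adm , good
  climb zero    x _ room | inj₂ (y , _ , up)    = ⊥-elim (<⇒≱ up (≤-trans (bounded y) room))
  climb (suc d) x _ room | inj₂ (y , adm , up) =
    climb d y adm (≤-trans room (≤-trans (≤-reflexive (sym (+-suc d (f x)))) (+-monoʳ-≤ d up)))

mainTheorem12 : (n k : ℕ) → 1 ≤ k → (p q : ℕ) → (E : BipGraph p q) →
    ¬ ContainsInduced-nΛ E n k →
    Σ (Subset p) λ S → (∣ S ∣ ≤ n ∸ 1) × (∀ a → ∣ E a ─ NS E S ∣ < k)
mainTheorem12 zero    k 1≤k p q E free = ⊥-elim (free (contains-0Λ E))
mainTheorem12 (suc m) k 1≤k p q E free =
  hill-climb (λ S → ∣ S ∣ ≤ m) (Covers E k) (λ S → ∣ NS E S ∣) q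
             (λ S → ∣p∣≤n (NS E S)) (improve E 1≤k free)
             ⊥ (subst (_≤ m) (sym (∣⊥∣≡0 p)) z≤n)
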